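{- Let $r\ge 4$ and let $G$ be a graph with $|V(G)|\ge r$ admitting an edge-coloring that makes it $C_r$-rainbow saturated. Then $\delta(G)\ge 2$.
   Context: All graphs are finite, simple and undirected. An edge-coloring is a function $E(G)\to\mathbb{N}$; a (sub)graph is rainbow if its edges have distinct colors. An edge-colored graph is $C_r$-rainbow saturated if it contains no rainbow cycle on $r$ vertices but adding any nonedge with any color creates a rainbow cycle on $r$ vertices. $\delta(G)$ is the minimum degree. -}

module Defs where

open import Data.Nat using (ℕ; zero; suc; _≤_)
open import Data.Fin using (Fin; zero; suc; _≟_)
open import Data.Bool using (Bool; true; false; _∧_; _∨_; if_then_else_)
open import Data.Product using (Σ; _×_; _,_)
open import Data.List using (List; filter; length; allFin)
open import Relation.Binary.PropositionalEquality using (_≡_; _≢_)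
open import Relation.Nullary.Decidable using (⌊_⌋)
open import Data.Bool.Properties using () renaming (_≟_ to _≟ᵇ_)
open import Function.Definitions using (Injective)

record Graph (n : ℕ) : Set where
  field
    adj    : Fin n → Fin n → Bool
    sym    : ∀ u v → adj u v ≡ adj v u
    irrefl : ∀ v → adj v v ≡ false
open Graph public

-- An edge-colouring: a symmetric function assigning a colour in ℕ to each
-- (unordered) pair; only its values on edges of the graph matter.
Coloring : ℕ → Set
Coloring n = Σ (Fin n → Fin n → ℕ) λ c → ∀ u v → c u v ≡ c v u

-- cyclic successor on Fin (suc m): i ↦ i+1, last ↦ 0
next : ∀ {m} → Fin (suc m) → Fin (suc m)
next {zero} zero = zero
next {suc m} zero = suc zero
next {suc m} (suc i) with next {m} i
... | zero = zero
... | suc j = suc (suc j)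

RainbowCycle : ∀ {n} (m : ℕ) → (Fin n → Fin n → Bool) → (Fin n → Fin n → ℕ) → Set
RainbowCycle {n} m a c =
  Σ (Fin (suc m) → Fin n) λ f →
    Injective _≡_ _≡_ f
    × (∀ i → a (f i) (f (next i)) ≡ true)
    × (∀ i j → i ≢ j → c (f i) (f (next i)) ≢ c (f j) (f (next j)))

samePair : ∀ {n} → Fin n → Fin n → Fin n → Fin n → Bool
samePair u v x y = (⌊ x ≟ u ⌋ ∧ ⌊ y ≟ v ⌋) ∨ (⌊ x ≟ v ⌋ ∧ ⌊ y ≟ u ⌋)

addAdj : ∀ {n} → Graph n → Fin n → Fin n → Fin n → Fin n → Bool
addAdj G u v x y = if samePair u v x y then true else adj G x y

addCol : ∀ {n} → (Fin n → Fin n → ℕ) → Fin n → Fin n → ℕ → Fin n → Fin n → ℕ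
addCol c u v k x y = if samePair u v x y then k else c x y

-- (G, c) is C_r-rainbow saturated, r = suc m: no rainbow C_r, and for every
-- nonedge uv (u ≠ v) and every colour k, G + uv coloured with uv ↦ k
-- contains a rainbow C_r.
RainbowSaturated : ∀ {n} (m : ℕ) → Graph n → Coloring n → Set
RainbowSaturated m G (c , _) =
  (RainbowCycle m (adj G) c → Data.Empty.⊥)
  × (∀ u v → u ≢ v → adj G u v ≡ false → ∀ (k : ℕ) →
       RainbowCycle m (addAdj G u v) (addCol c u v k))
  where import Data.Empty

degree : ∀ {n} → Graph n → Fin n → ℕ
degree G v = length (filter (λ w → adj G v w ≟ᵇ true) (allFin _))

MinDegreeAtLeast : ∀ {n} → ℕ → Graph n → Set
MinDegreeAtLeast d G = ∀ v → d ≤ degree G v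

{-# OPTIONS --safe #-}
module Submission where

-- Suppose a vertex v has at most one neighbour. As n ≥ 3 there is a vertex
-- u ≠ v not adjacent to v; add uv with the colour k of v's edge (any colour
-- if v is isolated). Then every edge of G + uv at v has colour k, so the
-- rainbow cycle that saturation provides in G + uv cannot pass through v,
-- whose two cycle edges would share that colour. Hence it avoids uv and is
-- already a rainbow cycle of G, which is impossible.

open import Defs hiding (sym)
open import Data.Bool using (true; false; _∧_; _∨_; if_then_else_)
open import Data.Bool.Properties using (∨-comm; ∧-comm) renaming (_≟_ to _≟ᵇ_)
open import Data.Empty using (⊥-elim)
open import Data.Fin using (Fin; zero; suc; fromℕ; inject₁; punchIn; _≟_)
open import Data.Fin.Properties
  using (any?; <⇒≢; ≤̄⇒inject₁<; punchInᵢ≢i; punchIn-injective)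
  renaming (≤-refl to ≤ᶠ-refl)
open import Data.Fin.Relation.Unary.Top using (view; ‵fromℕ; ‵inject₁)
open import Data.List using (List; []; _∷_; filter; length; allFin)
open import Data.List.Membership.Propositional using (_∈_)
open import Data.List.Membership.Propositional.Properties using (∈-filter⁺; ∈-allFin)
open import Data.List.Relation.Unary.Any using (here)
open import Data.Nat using (ℕ; zero; suc; _≤_; s≤s; _≤?_)
open import Data.Nat.Properties using (≤-pred; ≤-trans; ≰⇒>; n≤1+n)
open import Data.Product using (Σ; ∃-syntax; _×_; _,_; proj₁)
open import Data.Sum using (_⊎_; inj₁; inj₂)
open import Function using (_∘_; case_of_)
open import Relation.Binary.PropositionalEquality
  using (_≡_; _≢_; refl; sym; trans; cong; cong₂; module ≡-Reasoning)
open import Relation.Nullary using (¬_; Dec; yes; no; does)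
open import Relation.Nullary.Decidable using (⌊_⌋; _×-dec_; _⊎-dec_; isYes≗does; dec-true; dec-false)

private
  variable
    A : Set
    m n : ℕ

next-fromℕ : ∀ m → next (fromℕ m) ≡ zero
next-fromℕ zero = refl
next-fromℕ (suc m) rewrite next-fromℕ m = refl

next-inject₁ : (i : Fin m) → next (inject₁ i) ≡ suc i
next-inject₁ {suc m} zero = refl
next-inject₁ {suc m} (suc i) rewrite next-inject₁ i = refl

prev : Fin (suc m) → Fin (suc m)
prev {m} zero = fromℕ m
prev (suc i) = inject₁ i

next-prev : (i : Fin (suc m)) → next (prev i) ≡ i
next-prev {m} zero = next-fromℕ m
next-prev (suc i) = next-inject₁ i

next[i]≢i : (i : Fin (suc (suc m))) → next i ≢ i
next[i]≢i {m} i with view i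
... | ‵fromℕ rewrite next-fromℕ (suc m) = λ ()
... | ‵inject₁ j rewrite next-inject₁ j = <⇒≢ (≤̄⇒inject₁< ≤ᶠ-refl) ∘ sym

prev[i]≢i : (i : Fin (suc (suc m))) → prev i ≢ i
prev[i]≢i i prev[i]≡i = next[i]≢i i (trans (cong next (sym prev[i]≡i)) (next-prev i))

SamePair : A → A → A → A → Set
SamePair u v x y = (x ≡ u × y ≡ v) ⊎ (x ≡ v × y ≡ u)

samePair? : (u v x y : Fin n) → Dec (SamePair u v x y)
samePair? u v x y = (x ≟ u ×-dec y ≟ v) ⊎-dec (x ≟ v ×-dec y ≟ u)

module _ (u v : Fin n) where

  -- ⌊_⌋ is isYes, which only agrees with does propositionally.
  samePair≡does : ∀ {x y} → samePair u v x y ≡ does (samePair? u v x y)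
  samePair≡does {x} {y} =
    cong₂ _∨_ (cong₂ _∧_ (isYes≗does (x ≟ u)) (isYes≗does (y ≟ v)))
              (cong₂ _∧_ (isYes≗does (x ≟ v)) (isYes≗does (y ≟ u)))

  samePair-true : ∀ {x y} → SamePair u v x y → samePair u v x y ≡ true
  samePair-true {x} {y} p = trans (samePair≡does {x} {y}) (dec-true (samePair? u v x y) p)

  samePair-false : ∀ {x y} → ¬ SamePair u v x y → samePair u v x y ≡ false
  samePair-false {x} {y} ¬p = trans (samePair≡does {x} {y}) (dec-false (samePair? u v x y) ¬p)

  samePair-from-v : ∀ {y} → y ≢ u → samePair u v v y ≡ false
  samePair-from-v y≢u = samePair-false λ where
    (inj₁ (v≡u , y≡v)) → y≢u (trans y≡v v≡u)
    (inj₂ (_ , y≡u))   → y≢u y≡u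

  samePair-comm : ∀ x y → samePair u v x y ≡ samePair u v y x
  samePair-comm x y =
    trans (∨-comm (⌊ x ≟ u ⌋ ∧ ⌊ y ≟ v ⌋) _) (cong₂ _∨_ (∧-comm ⌊ x ≟ v ⌋ _) (∧-comm ⌊ x ≟ u ⌋ _))

module _ (G : Graph n) (u v : Fin n) {x y : Fin n} where

  addAdj-old : samePair u v x y ≡ false → addAdj G u v x y ≡ adj G x y
  addAdj-old = cong (if_then true else adj G x y)

  addAdj-comm : addAdj G u v x y ≡ addAdj G u v y x
  addAdj-comm = cong₂ (if_then true else_) (samePair-comm u v x y) (Graph.sym G x y)

module _ (c : Fin n → Fin n → ℕ) (u v : Fin n) (k : ℕ) {x y : Fin n} where

  addCol-new : samePair u v x y ≡ true → addCol c u v k x y ≡ k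
  addCol-new = cong (if_then k else c x y)

  addCol-old : samePair u v x y ≡ false → addCol c u v k x y ≡ c x y
  addCol-old = cong (if_then k else c x y)

  addCol-comm : (∀ x y → c x y ≡ c y x) → addCol c u v k x y ≡ addCol c u v k y x
  addCol-comm c-sym = cong₂ (if_then k else_) (samePair-comm u v x y) (c-sym x y)

module _ (G : Graph n) (c : Fin n → Fin n → ℕ) (u v : Fin n) (k : ℕ) where

  rainbowCycle-avoiding : (C : RainbowCycle m (addAdj G u v) (addCol c u v k)) →
                          (∀ i → proj₁ C i ≢ v) → RainbowCycle m (adj G) c
  rainbowCycle-avoiding (f , f-inj , f-adj , f-rainbow) v∉C =
    f , f-inj , (λ i → trans (sym (addAdj-old G u v (old i))) (f-adj i)) ,
    λ i j i≢j c≡ → f-rainbow i j i≢j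
      (trans (addCol-old c u v k (old i)) (trans c≡ (sym (addCol-old c u v k (old j)))))
    where
    old : ∀ i → samePair u v (f i) (f (next i)) ≡ false
    old i = samePair-false u v λ where
      (inj₁ (_ , f[next-i]≡v)) → v∉C (next i) f[next-i]≡v
      (inj₂ (f[i]≡v , _))      → v∉C i f[i]≡v

module _ (G : Graph n) (c : Fin n → Fin n → ℕ) (c-sym : ∀ x y → c x y ≡ c y x)
         {u v : Fin n} {k : ℕ} (v-edges : ∀ y → adj G v y ≡ true → c v y ≡ k) where

  addCol-from-v : ∀ {y} → addAdj G u v v y ≡ true → addCol c u v k v y ≡ k
  addCol-from-v {y} vy = case y ≟ u of λ where
    (yes y≡u) → addCol-new c u v k (samePair-true u v (inj₂ (refl , y≡u)))
    (no y≢u)  → trans (addCol-old c u v k (samePair-from-v u v y≢u))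
                      (v-edges y (trans (sym (addAdj-old G u v (samePair-from-v u v y≢u))) vy))

  addCol-at-v : ∀ {x y} → addAdj G u v x y ≡ true → x ≡ v ⊎ y ≡ v → addCol c u v k x y ≡ k
  addCol-at-v xy (inj₁ refl) = addCol-from-v xy
  addCol-at-v xy (inj₂ refl) =
    trans (addCol-comm c u v k c-sym) (addCol-from-v (trans (addAdj-comm G u v) xy))

  rainbowCycle-in-G : RainbowCycle (suc m) (addAdj G u v) (addCol c u v k) →
                      RainbowCycle (suc m) (adj G) c
  rainbowCycle-in-G C@(f , _ , f-adj , f-rainbow) with any? (λ p → f p ≟ v)
  ... | no v∉C = rainbowCycle-avoiding G c u v k C (λ i → v∉C ∘ (i ,_))
  ... | yes (p , f[p]≡v) = ⊥-elim (f-rainbow (prev p) p (prev[i]≢i p) (begin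
    addCol c u v k (f (prev p)) (f (next (prev p)))
      ≡⟨ addCol-at-v (f-adj (prev p)) (inj₂ (trans (cong f (next-prev p)) f[p]≡v)) ⟩
    k
      ≡⟨ sym (addCol-at-v (f-adj p) (inj₁ f[p]≡v)) ⟩
    addCol c u v k (f p) (f (next p)) ∎))
    where open ≡-Reasoning

length≤1⇒∈-unique : ∀ {xs : List A} {x y} → length xs ≤ 1 → x ∈ xs → y ∈ xs → x ≡ y
length≤1⇒∈-unique {xs = _ ∷ []}    _          (here refl) (here refl) = refl
length≤1⇒∈-unique {xs = _ ∷ _ ∷ _} (s≤s ()) _ _

module _ (G : Graph n) {v : Fin n} (deg≤1 : degree G v ≤ 1) where

  degree≤1⇒neighbour-unique : ∀ {x y} → adj G v x ≡ true → adj G v y ≡ true → x ≡ y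
  degree≤1⇒neighbour-unique vx vy = length≤1⇒∈-unique deg≤1 (∈-neighbours vx) (∈-neighbours vy)
    where
    ∈-neighbours : ∀ {w} → adj G v w ≡ true → w ∈ filter (λ w → adj G v w ≟ᵇ true) (allFin n)
    ∈-neighbours {w} vw = ∈-filter⁺ (λ w → adj G v w ≟ᵇ true) (∈-allFin w) vw

  degree≤1⇒monochromatic : (c : Fin n → Fin n → ℕ) → ∃[ k ] ∀ y → adj G v y ≡ true → c v y ≡ k
  degree≤1⇒monochromatic c with any? (λ w → adj G v w ≟ᵇ true)
  ... | yes (w , vw) = c v w , λ y vy → cong (c v) (degree≤1⇒neighbour-unique vy vw)
  ... | no isolated  = 0 , λ y vy → ⊥-elim (isolated (y , vy))

  non-neighbour-among : ∀ p q → p ≢ q → p ≢ v → q ≢ v → ∃[ u ] u ≢ v × adj G u v ≡ false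
  non-neighbour-among p q p≢q p≢v q≢v with adj G v p in vp | adj G v q in vq
  ... | false | _     = p , p≢v , trans (Graph.sym G p v) vp
  ... | _     | false = q , q≢v , trans (Graph.sym G q v) vq
  ... | true  | true  = ⊥-elim (p≢q (degree≤1⇒neighbour-unique vp vq))

  degree≤1⇒non-neighbour : 3 ≤ n → ∃[ u ] u ≢ v × adj G u v ≡ false
  degree≤1⇒non-neighbour (s≤s (s≤s (s≤s _))) =
    non-neighbour-among (punchIn v zero) (punchIn v (suc zero))
      ((λ ()) ∘ punchIn-injective v zero (suc zero)) (punchInᵢ≢i v zero) (punchInᵢ≢i v (suc zero))

rainbowSaturated⇒minDegree≥2 : 3 ≤ n → (G : Graph n) (C : Coloring n) →
                               RainbowSaturated (suc m) G C → MinDegreeAtLeast 2 G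
rainbowSaturated⇒minDegree≥2 3≤n G (c , c-sym) (no-rainbow , saturated) v with 2 ≤? degree G v
... | yes 2≤deg = 2≤deg
... | no 2≰deg =
  let deg≤1 = ≤-pred (≰⇒> 2≰deg)
      k , v-edges = degree≤1⇒monochromatic G deg≤1 c
      u , u≢v , u≁v = degree≤1⇒non-neighbour G deg≤1 3≤n
  in ⊥-elim (no-rainbow (rainbowCycle-in-G G c c-sym v-edges (saturated u v u≢v u≁v k)))

lemma2p5 : (n m : ℕ) → 4 ≤ suc m → suc m ≤ n → (G : Graph n)
    → Σ (Coloring n) (λ c → RainbowSaturated m G c)
    → MinDegreeAtLeast 2 G
lemma2p5 n m 4≤r@(s≤s (s≤s _)) r≤n G (C , saturated) =
  rainbowSaturated⇒minDegree≥2 (≤-trans (n≤1+n 3) (≤-trans 4≤r r≤n)) G C saturated
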